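{- Let $n>3$ and let $a,b$ be different digits from $\{1,3,7,9\}$. If $B_n(a,b)$ is an absolute prime, then $(a,b)\notin\{(9,7),(9,1),(1,7),(7,1),(3,9),(9,3)\}$.
   Context: An absolute prime is a positive integer which is prime and remains prime after an arbitrary permutation of the digits of its decimal representation. $A_n=(10^n-1)/9$ is the repunit with $n$ decimal digits all equal to $1$. For different digits $a,b$, $B_n(a,b)=a\cdot A_n+(b-a)$ is the $n$-digit number whose decimal representation consists of $n-1$ digits $a$ followed by a final digit $b$. -}

module Defs where

open import Data.Nat using (ℕ; zero; suc; _+_; _*_; _∸_; _^_; _/_; _%_)
open import Data.Nat.Primality using (Prime)
open import Data.List using (List; []; _∷_)
open import Data.List.Relation.Binary.Permutation.Propositional using (_↭_)

-- Decimal digits, least significant first, computed with fuel.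
-- (digitsAux n n) terminates with the full expansion since a number m
-- has at most m decimal digits.
digitsAux : ℕ → ℕ → List ℕ
digitsAux zero    m = []
digitsAux (suc f) zero = []
digitsAux (suc f) m@(suc _) = (m % 10) ∷ digitsAux f (m / 10)

-- Decimal representation of m (least significant digit first);
-- for m = 0 this is the empty list (irrelevant for primes).
decDigits : ℕ → List ℕ
decDigits m = digitsAux m m

fromDigits : List ℕ → ℕ
fromDigits []       = 0
fromDigits (d ∷ ds) = d + 10 * fromDigits ds

AbsolutePrime : ℕ → Set
AbsolutePrime m = Prime m × (∀ ds → ds ↭ decDigits m → Prime (fromDigits ds))
  where open import Data.Product using (_×_)

A : ℕ → ℕ
A n = (10 ^ n ∸ 1) / 9

-- B_n(a,b) = a * A_n + (b - a)  (as an integer; written here for ℕ as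
-- a * A_n + b - a, which is nonnegative since a * A_n ≥ a for n ≥ 1)
B : ℕ → ℕ → ℕ → ℕ
B n a b = a * A n + b ∸ a

-- Every permutation of the digits of B_n(a,b) is an arrangement a…a b a…a, so it
-- suffices to exhibit one composite arrangement for each n.  If 1 < p and p
-- divides both an arrangement and the block a…a of length o, then p still
-- divides the arrangement after o more digits a are put on top, so one witness
-- per residue class of n modulo o settles all n.  The period is 6 for (9,7),
-- (9,1) and (1,7), 18 for (7,1) (after sporadic cases n ≤ 10) and 1 for (3,9)
-- and (9,3).  The class n ≡ 0 (mod 6) of (9,7) and (9,1) is covered
-- algebraically instead: with X = 10^h, the 2h-digit number 9…91 is
-- X² − 9 = (X − 3)(X + 3), and the 3h-digit number 9…979…9 with h nines after
-- the 7 is X³ − 2X − 1 = (X + 1)(X² − X − 1).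
module Submission where

open import Defs
open import Data.Nat
open import Data.Nat.Properties
open import Data.Nat.DivMod
open import Data.Nat.Divisibility
open import Data.Nat.Primality using (Composite; composite; prime⇒¬composite)
open import Data.Nat.Tactic.RingSolver using (solve-∀)
open import Data.List using (List; []; _∷_; _++_; replicate; length)
open import Data.List.Properties using (++-assoc; length-++; length-replicate)
open import Data.List.Membership.Propositional using (_∈_)
open import Data.List.Relation.Unary.All using (All; []; _∷_; all?)
import Data.List.Relation.Unary.All as All
open import Data.List.Relation.Unary.All.Properties using (replicate⁺)
open import Data.List.Relation.Unary.Any using (here; there)
open import Data.List.Relation.Binary.Permutation.Propositional using (_↭_)
open import Data.List.Relation.Binary.Permutation.Propositional.Properties using (shift)
open import Data.Product using (_,_; _×_)
open import Data.Sum using (_⊎_; inj₁; inj₂)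
import Data.Sum as Sum
open import Relation.Binary.PropositionalEquality
open import Relation.Nullary using (¬_; Dec)
open import Relation.Nullary.Decidable using (True; toWitness; _×-dec_)

open ≡-Reasoning

NonZeroDigit : ℕ → Set
NonZeroDigit d = 0 < d × d < 10

nonZeroDigit? : (d : ℕ) → Dec (NonZeroDigit d)
nonZeroDigit? d = (0 <? d) ×-dec (d <? 10)

oddDigit⇒nonZeroDigit : ∀ {d} → d ∈ (1 ∷ 3 ∷ 7 ∷ 9 ∷ []) → NonZeroDigit d
oddDigit⇒nonZeroDigit = All.lookup (toWitness {a? = all? nonZeroDigit? (1 ∷ 3 ∷ 7 ∷ 9 ∷ [])} _)

replicate-+ : ∀ {A : Set} m n (x : A) → replicate (m + n) x ≡ replicate m x ++ replicate n x
replicate-+ zero    n x = refl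
replicate-+ (suc m) n x = cong (x ∷_) (replicate-+ m n x)

fromDigits-++ : ∀ xs ys → fromDigits (xs ++ ys) ≡ fromDigits xs + 10 ^ length xs * fromDigits ys
fromDigits-++ []       ys = sym (+-identityʳ _)
fromDigits-++ (x ∷ xs) ys = begin
  x + 10 * fromDigits (xs ++ ys)                            ≡⟨ cong (λ v → x + 10 * v) (fromDigits-++ xs ys) ⟩
  x + 10 * (fromDigits xs + 10 ^ length xs * fromDigits ys) ≡⟨ distrib x (fromDigits xs) (10 ^ length xs) (fromDigits ys) ⟩
  x + 10 * fromDigits xs + 10 * 10 ^ length xs * fromDigits ys ∎
  where
  distrib : ∀ x f t g → x + 10 * (f + t * g) ≡ x + 10 * f + 10 * t * g
  distrib = solve-∀

[d+10x]%10≡d : ∀ {d} x → d < 10 → (d + 10 * x) % 10 ≡ d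
[d+10x]%10≡d {d} x d<10 = begin
  (d + 10 * x) % 10 ≡⟨ cong (λ v → (d + v) % 10) (*-comm 10 x) ⟩
  (d + x * 10) % 10 ≡⟨ [m+kn]%n≡m%n d x 10 ⟩
  d % 10            ≡⟨ m<n⇒m%n≡m d<10 ⟩
  d                 ∎

[d+10x]/10≡x : ∀ {d} x → d < 10 → (d + 10 * x) / 10 ≡ x
[d+10x]/10≡x {d} x d<10 = begin
  (d + 10 * x) / 10     ≡⟨ +-distrib-/-∣ʳ d (m∣m*n x) ⟩
  d / 10 + 10 * x / 10  ≡⟨ cong₂ _+_ (m<n⇒m/n≡0 d<10) (cong (_/ 10) (*-comm 10 x)) ⟩
  x * 10 / 10           ≡⟨ m*n/n≡m x 10 ⟩
  x                     ∎

length≤fromDigits : ∀ {ds} → All NonZeroDigit ds → length ds ≤ fromDigits ds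
length≤fromDigits []                   = z≤n
length≤fromDigits {_ ∷ ds} ((0<d , _) ∷ nz) =
  +-mono-≤ 0<d (≤-trans (length≤fromDigits nz) (m≤n*m (fromDigits ds) 10))

digitsAux-fromDigits : ∀ {f ds} → All NonZeroDigit ds → length ds ≤ f →
                       digitsAux f (fromDigits ds) ≡ ds
digitsAux-fromDigits {zero}  []       _ = refl
digitsAux-fromDigits {suc f} []       _ = refl
digitsAux-fromDigits {suc f} {_ ∷ ds} ((s≤s z≤n , d<10) ∷ nz) (s≤s len≤f) =
  cong₂ _∷_ ([d+10x]%10≡d (fromDigits ds) d<10)
            (trans (cong (digitsAux f) ([d+10x]/10≡x (fromDigits ds) d<10))
                   (digitsAux-fromDigits nz len≤f))

decDigits-fromDigits : ∀ {ds} → All NonZeroDigit ds → decDigits (fromDigits ds) ≡ ds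
decDigits-fromDigits nz = digitsAux-fromDigits nz (length≤fromDigits nz)

repunit : ℕ → ℕ
repunit zero    = 0
repunit (suc n) = 1 + 10 * repunit n

fromDigits-replicate : ∀ n d → fromDigits (replicate n d) ≡ d * repunit n
fromDigits-replicate zero    d = sym (*-zeroʳ d)
fromDigits-replicate (suc n) d = begin
  d + 10 * fromDigits (replicate n d) ≡⟨ cong (λ v → d + 10 * v) (fromDigits-replicate n d) ⟩
  d + 10 * (d * repunit n)            ≡⟨ factor d (repunit n) ⟩
  d * (1 + 10 * repunit n)            ∎
  where
  factor : ∀ d r → d + 10 * (d * r) ≡ d * (1 + 10 * r)
  factor = solve-∀

10^n≡1+9*repunit : ∀ n → 10 ^ n ≡ 1 + 9 * repunit n
10^n≡1+9*repunit zero    = refl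
10^n≡1+9*repunit (suc n) = begin
  10 * 10 ^ n                ≡⟨ cong (10 *_) (10^n≡1+9*repunit n) ⟩
  10 * (1 + 9 * repunit n)   ≡⟨ expand (repunit n) ⟩
  1 + 9 * (1 + 10 * repunit n) ∎
  where
  expand : ∀ r → 10 * (1 + 9 * r) ≡ 1 + 9 * (1 + 10 * r)
  expand = solve-∀

A≡repunit : ∀ n → A n ≡ repunit n
A≡repunit n = begin
  (10 ^ n ∸ 1) / 9           ≡⟨ cong (λ v → (v ∸ 1) / 9) (10^n≡1+9*repunit n) ⟩
  (1 + 9 * repunit n ∸ 1) / 9 ≡⟨ cong (_/ 9) (trans (m+n∸m≡n 1 (9 * repunit n)) (*-comm 9 (repunit n))) ⟩
  repunit n * 9 / 9          ≡⟨ m*n/n≡m (repunit n) 9 ⟩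
  repunit n                  ∎

B≡fromDigits : ∀ n a b → B (suc n) a b ≡ fromDigits (b ∷ replicate n a)
B≡fromDigits n a b = begin
  a * A (suc n) + b ∸ a                  ≡⟨ cong (λ v → a * v + b ∸ a) (A≡repunit (suc n)) ⟩
  a * (1 + 10 * repunit n) + b ∸ a       ≡⟨ cong (_∸ a) (expand a b (repunit n)) ⟩
  a + (b + 10 * (a * repunit n)) ∸ a     ≡⟨ m+n∸m≡n a _ ⟩
  b + 10 * (a * repunit n)               ≡⟨ cong (λ v → b + 10 * v) (fromDigits-replicate n a) ⟨
  b + 10 * fromDigits (replicate n a)    ∎
  where
  expand : ∀ a b r → a * (1 + 10 * r) + b ≡ a + (b + 10 * (a * r))
  expand = solve-∀

decDigits-B : ∀ {n a b} → NonZeroDigit a → NonZeroDigit b → decDigits (B (suc n) a b) ≡ b ∷ replicate n a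
decDigits-B {n} {a} {b} da db =
  trans (cong decDigits (B≡fromDigits n a b)) (decDigits-fromDigits (db ∷ replicate⁺ n da))

arrangement : ℕ → ℕ → ℕ → ℕ → List ℕ
arrangement a b k m = replicate k a ++ b ∷ replicate m a

arrangement↭ : ∀ a b k m → arrangement a b k m ↭ b ∷ replicate (k + m) a
arrangement↭ a b k m rewrite replicate-+ k m a = shift b (replicate k a) (replicate m a)

length-arrangement : ∀ a b k m → length (arrangement a b k m) ≡ k + suc m
length-arrangement a b k m =
  trans (length-++ (replicate k a)) (cong₂ _+_ (length-replicate k) (cong suc (length-replicate m)))

fromDigits-arrangement-+ : ∀ a b k m o →
  fromDigits (arrangement a b k (m + o)) ≡
  fromDigits (arrangement a b k m) + 10 ^ (k + suc m) * fromDigits (replicate o a)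
fromDigits-arrangement-+ a b k m o = begin
  fromDigits (replicate k a ++ b ∷ replicate (m + o) a)
    ≡⟨ cong (λ xs → fromDigits (replicate k a ++ b ∷ xs)) (replicate-+ m o a) ⟩
  fromDigits (replicate k a ++ b ∷ replicate m a ++ replicate o a)
    ≡⟨ cong fromDigits (++-assoc (replicate k a) (b ∷ replicate m a) (replicate o a)) ⟨
  fromDigits (arrangement a b k m ++ replicate o a)
    ≡⟨ fromDigits-++ (arrangement a b k m) (replicate o a) ⟩
  fromDigits (arrangement a b k m) + 10 ^ length (arrangement a b k m) * fromDigits (replicate o a)
    ≡⟨ cong (λ l → fromDigits (arrangement a b k m) + 10 ^ l * fromDigits (replicate o a))
            (length-arrangement a b k m) ⟩
  fromDigits (arrangement a b k m) + 10 ^ (k + suc m) * fromDigits (replicate o a) ∎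

record CompositeArrangement (a b n : ℕ) : Set where
  constructor compositeArrangement
  field
    {k m}       : ℕ
    length≡     : k + suc m ≡ n
    isComposite : Composite (fromDigits (arrangement a b k m))

compositeArrangement⇒¬absolutePrime : ∀ {a b n} → NonZeroDigit a → NonZeroDigit b →
  CompositeArrangement a b n → ¬ AbsolutePrime (B n a b)
compositeArrangement⇒¬absolutePrime {a} {b} da db (compositeArrangement {k} {m} refl c) (_ , permutationsPrime) =
  prime⇒¬composite (permutationsPrime (arrangement a b k m) permutation) c
  where
  digits : decDigits (B (k + suc m) a b) ≡ b ∷ replicate (k + m) a
  digits = trans (cong (λ n → decDigits (B n a b)) (+-suc k m)) (decDigits-B da db)
  permutation : arrangement a b k m ↭ decDigits (B (k + suc m) a b)
  permutation = subst (arrangement a b k m ↭_) (sym digits) (arrangement↭ a b k m)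

record PeriodicWitness (a b o n : ℕ) : Set where
  constructor periodicWitness
  field
    {k m p}         : ℕ
    .{{nontrivial}} : NonTrivial p
    length≡         : k + suc m ≡ n
    p<value         : p < fromDigits (arrangement a b k m)
    p∣value         : p ∣ fromDigits (arrangement a b k m)
    p∣block         : p ∣ fromDigits (replicate o a)

  toCompositeArrangement : CompositeArrangement a b n
  toCompositeArrangement = compositeArrangement length≡ (composite p<value p∣value)

open PeriodicWitness using (toCompositeArrangement)

extend : ∀ {a b o n} → PeriodicWitness a b o n → PeriodicWitness a b o (o + n)
extend {a} {b} {o} (periodicWitness {k} {m} {p} refl p<value p∣value p∣block) =
  periodicWitness (longer k m o)
    (subst (p <_) (sym value≡) (<-≤-trans p<value (m≤m+n _ _)))
    (subst (p ∣_) (sym value≡) (∣m∣n⇒∣m+n p∣value (∣n⇒∣m*n (10 ^ (k + suc m)) p∣block)))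
    p∣block
  where
  value≡ : fromDigits (arrangement a b k (m + o)) ≡
           fromDigits (arrangement a b k m) + 10 ^ (k + suc m) * fromDigits (replicate o a)
  value≡ = fromDigits-arrangement-+ a b k m o
  longer : ∀ k m o → k + suc (m + o) ≡ o + (k + suc m)
  longer = solve-∀

periodic : ∀ {a b o} k m p .{{_ : NonTrivial p}} →
  {True (p <? fromDigits (arrangement a b k m))} →
  {True (p ∣? fromDigits (arrangement a b k m))} →
  {True (p ∣? fromDigits (replicate o a))} →
  PeriodicWitness a b o (k + suc m)
periodic k m p {p<value} {p∣value} {p∣block} =
  periodicWitness refl (toWitness p<value) (toWitness p∣value) (toWitness p∣block)

sporadic : ∀ {a b} k m p .{{_ : NonTrivial p}} →
  {True (p <? fromDigits (arrangement a b k m))} →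
  {True (p ∣? fromDigits (arrangement a b k m))} →
  CompositeArrangement a b (k + suc m)
sporadic k m p {p<value} {p∣value} =
  compositeArrangement refl (composite (toWitness p<value) (toWitness p∣value))

fromDigits-nines-arrangement : ∀ b c k m → b + c ≡ 9 →
  fromDigits (arrangement 9 b k m) + c * 10 ^ k + 1 ≡ 10 ^ (k + suc m)
fromDigits-nines-arrangement b c k m b+c≡9 = begin
  fromDigits (arrangement 9 b k m) + c * 10 ^ k + 1
    ≡⟨ cong (λ v → v + c * 10 ^ k + 1) (fromDigits-++ (replicate k 9) (b ∷ replicate m 9)) ⟩
  fromDigits (replicate k 9) + 10 ^ length (replicate k 9) * (b + 10 * fromDigits (replicate m 9)) + c * 10 ^ k + 1
    ≡⟨ cong₂ (λ l v → fromDigits (replicate k 9) + 10 ^ l * (b + 10 * v) + c * 10 ^ k + 1)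
             (length-replicate k) (fromDigits-replicate m 9) ⟩
  fromDigits (replicate k 9) + 10 ^ k * (b + 10 * (9 * repunit m)) + c * 10 ^ k + 1
    ≡⟨ cong₂ (λ v x → v + x * (b + 10 * (9 * repunit m)) + c * x + 1)
             (fromDigits-replicate k 9) (10^n≡1+9*repunit k) ⟩
  9 * repunit k + (1 + 9 * repunit k) * (b + 10 * (9 * repunit m)) + c * (1 + 9 * repunit k) + 1
    ≡⟨ collect (repunit k) (repunit m) b c ⟩
  (1 + 9 * repunit k) * (1 + (b + c) + 90 * repunit m)
    ≡⟨ cong (λ s → (1 + 9 * repunit k) * (1 + s + 90 * repunit m)) b+c≡9 ⟩
  (1 + 9 * repunit k) * (10 + 90 * repunit m)
    ≡⟨ tidy (repunit k) (repunit m) ⟩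
  (1 + 9 * repunit k) * (10 * (1 + 9 * repunit m))
    ≡⟨ cong₂ (λ x y → x * (10 * y)) (10^n≡1+9*repunit k) (10^n≡1+9*repunit m) ⟨
  10 ^ k * 10 ^ suc m
    ≡⟨ ^-distribˡ-+-* 10 k (suc m) ⟨
  10 ^ (k + suc m) ∎
  where
  collect : ∀ r s b c → 9 * r + (1 + 9 * r) * (b + 10 * (9 * s)) + c * (1 + 9 * r) + 1 ≡
                        (1 + 9 * r) * (1 + (b + c) + 90 * s)
  collect = solve-∀
  tidy : ∀ r s → (1 + 9 * r) * (10 + 90 * s) ≡ (1 + 9 * r) * (10 * (1 + 9 * s))
  tidy = solve-∀

composite-* : ∀ {x y} → 1 < x → 1 < y → Composite (x * y)
composite-* {x} {y} 1<x 1<y = composite (m<m*n x y 1<y) (m∣m*n y)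
  where instance
  _ : NonTrivial x
  _ = n>1⇒nonTrivial 1<x
  _ : NonZero x
  _ = >-nonZero (<-trans z<s 1<x)

composite-square∸9 : ∀ {v x} → 5 ≤ x → v + 9 ≡ x * x → Composite v
composite-square∸9 {v} 5≤x v+9≡x² with t , refl ← m≤n⇒∃[o]m+o≡n 5≤x =
  subst Composite (sym v≡) (composite-* {2 + t} {8 + t} (s≤s (s≤s z≤n)) (s≤s (s≤s z≤n)))
  where
  v≡ : v ≡ (2 + t) * (8 + t)
  v≡ = +-cancelʳ-≡ 9 v _ (trans v+9≡x² (factor t))
    where
    factor : ∀ t → (5 + t) * (5 + t) ≡ (2 + t) * (8 + t) + 9
    factor = solve-∀

composite-cube∸2x+1 : ∀ {v x} → 3 ≤ x → v + 2 * x + 1 ≡ x * (x * x) → Composite v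
composite-cube∸2x+1 {v} 3≤x v+2x+1≡x³ with t , refl ← m≤n⇒∃[o]m+o≡n 3≤x =
  subst Composite (sym v≡) (composite-* {4 + t} {5 + 5 * t + t * t} (s≤s (s≤s z≤n)) (s≤s (s≤s z≤n)))
  where
  v≡ : v ≡ (4 + t) * (5 + 5 * t + t * t)
  v≡ = +-cancelʳ-≡ (2 * (3 + t) + 1) v _ (trans (sym (+-assoc v (2 * (3 + t)) 1)) (trans v+2x+1≡x³ (factor t)))
    where
    factor : ∀ t → (3 + t) * ((3 + t) * (3 + t)) ≡ (4 + t) * (5 + 5 * t + t * t) + (2 * (3 + t) + 1)
    factor = solve-∀

10≤10^suc : ∀ h → 10 ≤ 10 ^ suc h
10≤10^suc h = ^-monoʳ-≤ 10 {1} {suc h} (s≤s z≤n)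

squareArrangement91 : ∀ h → CompositeArrangement 9 1 (suc h * 2)
squareArrangement91 h =
  compositeArrangement {k = 0} (length≡ h) (composite-square∸9 (≤-trans (m≤m+n 5 5) (10≤10^suc h)) value+9≡X²)
  where
  X value : ℕ
  X = 10 ^ suc h
  value = fromDigits (arrangement 9 1 0 (h + suc h))
  value+9≡X² : value + 9 ≡ X * X
  value+9≡X² = begin
    value + 9              ≡⟨ +-assoc value 8 1 ⟨
    value + 8 + 1          ≡⟨ fromDigits-nines-arrangement 1 8 0 (h + suc h) refl ⟩
    10 ^ (suc h + suc h)   ≡⟨ ^-distribˡ-+-* 10 (suc h) (suc h) ⟩
    X * X                  ∎
  length≡ : ∀ h → suc (h + suc h) ≡ suc h * 2
  length≡ = solve-∀

cubeArrangement97 : ∀ h → CompositeArrangement 9 7 (suc h * 3)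
cubeArrangement97 h =
  compositeArrangement {k = suc h} (length≡ h) (composite-cube∸2x+1 (≤-trans (m≤m+n 3 7) (10≤10^suc h)) value+2X+1≡X³)
  where
  X value : ℕ
  X = 10 ^ suc h
  value = fromDigits (arrangement 9 7 (suc h) (h + suc h))
  value+2X+1≡X³ : value + 2 * X + 1 ≡ X * (X * X)
  value+2X+1≡X³ = begin
    value + 2 * X + 1               ≡⟨ fromDigits-nines-arrangement 7 2 (suc h) (h + suc h) refl ⟩
    10 ^ (suc h + (suc h + suc h))  ≡⟨ ^-distribˡ-+-* 10 (suc h) (suc h + suc h) ⟩
    X * 10 ^ (suc h + suc h)        ≡⟨ cong (X *_) (^-distribˡ-+-* 10 (suc h) (suc h)) ⟩
    X * (X * X)                     ∎
  length≡ : ∀ h → suc h + suc (h + suc h) ≡ suc h * 3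
  length≡ = solve-∀

pattern 6+ n = suc (suc (suc (suc (suc (suc n)))))
pattern 18+ n = 6+ (6+ (6+ n))

witness97 : ∀ i → PeriodicWitness 9 7 6 (4 + i) ⊎ 3 ∣ 4 + i
witness97 0      = inj₁ (periodic 0 3 13)
witness97 1      = inj₁ (periodic 1 3 11)
witness97 2      = inj₂ (divides 2 refl)
witness97 3      = inj₁ (periodic 0 6 7)
witness97 4      = inj₁ (periodic 4 3 7)
witness97 5      = inj₁ (periodic 1 7 11)
witness97 (6+ i) = Sum.map extend (∣m∣n⇒∣m+n (divides 2 refl)) (witness97 i)

compositeArrangement97 : ∀ i → CompositeArrangement 9 7 (4 + i)
compositeArrangement97 i with witness97 i
... | inj₁ w                      = toCompositeArrangement w
... | inj₂ (divides zero ())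
... | inj₂ (divides (suc h) n≡h*3) = subst (CompositeArrangement 9 7) (sym n≡h*3) (cubeArrangement97 h)

witness91 : ∀ i → PeriodicWitness 9 1 6 (4 + i) ⊎ 2 ∣ 4 + i
witness91 0      = inj₁ (periodic 1 2 7)
witness91 1      = inj₁ (periodic 4 0 7)
witness91 2      = inj₂ (divides 3 refl)
witness91 3      = inj₁ (periodic 2 4 7)
witness91 4      = inj₁ (periodic 0 7 7)
witness91 5      = inj₁ (periodic 4 4 13)
witness91 (6+ i) = Sum.map extend (∣m∣n⇒∣m+n (divides 3 refl)) (witness91 i)

compositeArrangement91 : ∀ i → CompositeArrangement 9 1 (4 + i)
compositeArrangement91 i with witness91 i
... | inj₁ w                      = toCompositeArrangement w
... | inj₂ (divides zero ())
... | inj₂ (divides (suc h) n≡h*2) = subst (CompositeArrangement 9 1) (sym n≡h*2) (squareArrangement91 h)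

witness17 : ∀ i → PeriodicWitness 1 7 6 (4 + i)
witness17 0      = periodic 3 0 13
witness17 1      = periodic 2 2 7
witness17 2      = periodic 0 5 3
witness17 3      = periodic 0 6 7
witness17 4      = periodic 2 5 13
witness17 5      = periodic 0 8 3
witness17 (6+ i) = extend (witness17 i)

witness39 : ∀ i → PeriodicWitness 3 9 1 (4 + i)
witness39 zero    = periodic 0 3 3
witness39 (suc i) = extend (witness39 i)

witness93 : ∀ i → PeriodicWitness 9 3 1 (4 + i)
witness93 zero    = periodic 0 3 3
witness93 (suc i) = extend (witness93 i)

witness71 : ∀ i → PeriodicWitness 7 1 18 (11 + i)
witness71 0       = periodic 5 5 13
witness71 1       = periodic 0 11 3
witness71 2       = periodic 1 11 19
witness71 3       = periodic 5 8 19
witness71 4       = periodic 0 14 3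
witness71 5       = periodic 3 12 19
witness71 6       = periodic 5 11 13
witness71 7       = periodic 0 17 3
witness71 8       = periodic 3 15 13
witness71 9       = periodic 14 5 19
witness71 10      = periodic 0 20 3
witness71 11      = periodic 0 21 19
witness71 12      = periodic 5 17 13
witness71 13      = periodic 0 23 3
witness71 14      = periodic 3 21 13
witness71 15      = periodic 12 13 19
witness71 16      = periodic 0 26 3
witness71 17      = periodic 13 14 19
witness71 (18+ i) = extend (witness71 i)

compositeArrangement71 : ∀ i → CompositeArrangement 7 1 (4 + i)
compositeArrangement71 0            = sporadic 0 3 19
compositeArrangement71 1            = sporadic 0 4 83
compositeArrangement71 2            = sporadic 0 5 3
compositeArrangement71 3            = sporadic 0 6 29
compositeArrangement71 4            = sporadic 0 7 17
compositeArrangement71 5            = sporadic 0 8 3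
compositeArrangement71 6            = sporadic 2 7 29
compositeArrangement71 (suc (6+ i)) = toCompositeArrangement (witness71 i)

excludedPair⇒compositeArrangement : ∀ {a b} i →
  (a , b) ∈ ((9 , 7) ∷ (9 , 1) ∷ (1 , 7) ∷ (7 , 1) ∷ (3 , 9) ∷ (9 , 3) ∷ []) →
  CompositeArrangement a b (4 + i)
excludedPair⇒compositeArrangement i (here refl)                                          = compositeArrangement97 i
excludedPair⇒compositeArrangement i (there (here refl))                                  = compositeArrangement91 i
excludedPair⇒compositeArrangement i (there (there (here refl)))                          = toCompositeArrangement (witness17 i)
excludedPair⇒compositeArrangement i (there (there (there (here refl))))                  = compositeArrangement71 i
excludedPair⇒compositeArrangement i (there (there (there (there (here refl)))))          = toCompositeArrangement (witness39 i)
excludedPair⇒compositeArrangement i (there (there (there (there (there (here refl))))))  = toCompositeArrangement (witness93 i)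

theorem3 : (n a b : ℕ) → 3 < n →
    a ∈ (1 ∷ 3 ∷ 7 ∷ 9 ∷ []) → b ∈ (1 ∷ 3 ∷ 7 ∷ 9 ∷ []) → a ≢ b →
    AbsolutePrime (B n a b) →
    ¬ ((a , b) ∈ ((9 , 7) ∷ (9 , 1) ∷ (1 , 7) ∷ (7 , 1) ∷ (3 , 9) ∷ (9 , 3) ∷ []))
theorem3 n a b 3<n a∈ b∈ _ absolutePrime excluded with i , refl ← m≤n⇒∃[o]m+o≡n 3<n =
  compositeArrangement⇒¬absolutePrime (oddDigit⇒nonZeroDigit a∈) (oddDigit⇒nonZeroDigit b∈)
    (excludedPair⇒compositeArrangement i excluded) absolutePrime
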